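{- Let $k$ be a positive integer. For each Dyck path $D\in\operatorname{Dyck}(k)$, define \[ \operatorname{wt}(D) := \prod_{i=1}^{k-1} \# \left\{ j \in \mathbb{Z} \,:\, i+j > k \text{ and } (i,j) \in D \right\}. \] Then \[ \sum_{D \in \operatorname{Dyck}(k)} \operatorname{wt}(D) = \frac{1}{k} \binom{3k-2}{k-1}. \]
   Context: $\operatorname{Dyck}(k)$ is the set of lattice paths from $(0,k)$ to $(k,0)$ consisting of $k$ unit steps $(1,0)$ and $k$ unit steps $(0,-1)$ that never go strictly below the line $X+Y=k$. Each path is regarded as a subset of $\mathbb{R}^2$ (the union of its unit segments), so $(i,j)\in D$ means the point $(i,j)$ lies on the path. -}

module Defs where

open import Data.Nat using (ℕ; zero; suc; _+_; _*_; _∸_; _≤_; _<_; _≤?_; _<?_)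
open import Data.Nat.Properties using (_≟_)
open import Data.Bool using (Bool; true; false; _∧_)
open import Data.Product using (_×_; _,_; proj₁; proj₂)
open import Data.List using (List; []; _∷_; map; concatMap; filter; length; applyUpTo)
open import Data.Bool.ListAction using (and)
open import Data.Nat.ListAction using (product)
open import Relation.Nullary.Decidable using (⌊_⌋; _×-dec_)

data Step : Set where
  E S : Step

Point : Set
Point = ℕ × ℕ

step : Step → Point → Point
step E (x , y) = (suc x , y)
step S (x , y) = (x , y ∸ 1)

verticesFrom : Point → List Step → List Point
verticesFrom p []       = p ∷ []
verticesFrom p (s ∷ ss) = p ∷ verticesFrom (step s p) ss

vertices : ℕ → List Step → List Point
vertices k w = verticesFrom (0 , k) w

isE : Step → Bool
isE E = true
isE S = false

isS : Step → Bool
isS E = false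
isS S = true

countE countS : List Step → ℕ
countE w = length (filter (λ s → isE s Data.Bool.≟ true) w)
countS w = length (filter (λ s → isS s Data.Bool.≟ true) w)

words : ℕ → List (List Step)
words zero    = [] ∷ []
words (suc n) = concatMap (λ w → (E ∷ w) ∷ (S ∷ w) ∷ []) (words n)

isDyck? : (k : ℕ) (w : List Step) → Bool
isDyck? k w = ⌊ countE w ≟ k ⌋ ∧ ⌊ countS w ≟ k ⌋
  ∧ and (map (λ p → ⌊ k ≤? proj₁ p + proj₂ p ⌋) (vertices k w))

Dyck : ℕ → List (List Step)
Dyck k = filter (λ w → isDyck? k w Data.Bool.≟ true) (words (k + k))

-- #{ j : i + j > k and (i,j) ∈ D }.  The integer points on D (a union of unit
-- segments between lattice points) are exactly its vertices, which are distinct.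
column : ℕ → List Step → ℕ → ℕ
column k w i = length (filter (λ p → (proj₁ p ≟ i) ×-dec (k <? i + proj₂ p)) (vertices k w))

wt : ℕ → List Step → ℕ
wt k w = product (applyUpTo (λ m → column k w (suc m)) (k ∸ 1))

{-# OPTIONS --safe #-}
module Submission where

open import Defs
open import Data.Bool using (Bool; true; false; _∧_)
import Data.Bool
open import Data.Bool.ListAction using (and)
open import Data.Bool.Properties using (∧-assoc; ∧-identityʳ; ∧-zeroʳ)
open import Data.List using (List; []; _∷_; _++_; map; filter; length; applyUpTo; concatMap)
open import Data.List.Properties
  using (map-cong; map-++; filter-++; length-++; filter-none; filter-reject; applyUpTo-∷ʳ)
open import Data.List.Relation.Unary.All as All using (All; []; _∷_)
open import Data.Nat
  using (ℕ; zero; suc; pred; _+_; _*_; _∸_; _≤_; _<_; _/_; _≤?_; _<?_; NonZero; z≤n; s≤s; z<s; s<s)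
open import Data.Nat.Combinatorics using (_C_; nC1≡n; nCk+nC[k+1]≡[n+1]C[k+1])
open import Data.Nat.DivMod using (m*n/n≡m)
open import Data.Nat.ListAction using (sum; product)
open import Data.Nat.ListAction.Properties using (product-++)
open import Data.Nat.Properties
open import Data.Nat.Tactic.RingSolver using (solve-∀)
open import Data.Product using (_×_; _,_; proj₁; proj₂)
open import Function using (_∘_)
open import Function.Bundles using (_⇔_; mk⇔)
open import Level using (0ℓ)
open import Relation.Binary.PropositionalEquality
open import Relation.Nullary using (Dec; yes; no; does)
open import Relation.Nullary.Decidable using (⌊_⌋; dec-true; dec-false; does-⇔; isYes≗does; _×-dec_)
open import Relation.Unary using (Pred; Decidable)
open import Algebra.Properties.CommutativeSemigroup +-commutativeSemigroup using (interchange)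

-- Cut a Dyck path after each of its steps.  A prefix with a east and b south steps ends at
-- (a, k − b); the vertex added by its last step is counted in its column exactly when it lies
-- strictly above the diagonal, i.e. when b < a.  Hence the total weight W(a, b) of all prefixes
-- ending at (a, k − b), a product over the columns 1, …, a, and the weight W⁻(a, b) over the
-- columns 1, …, a − 1, satisfy a transfer recursion in which k no longer occurs.  Writing
-- a = b + d + 1, that recursion is the recurrence R(j+1, m+1) = R(j+1, m) + R(j, m+3) of the
-- Raney numbers R(j, m) = m/(3j+m)·C(3j+m, j), with W⁻(a, b) = R(b, 2d + 2) and
-- W(a, b) = R(b, 2d + 3).  A Dyck path ends on the diagonal at (k, 0), where W⁻(k, k) =
-- W⁻(k, k − 1) = R(k − 1, 2) = C(3k − 2, k − 1)/k.

infixl 7 _when_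

_when_ : ℕ → Bool → ℕ
n when true  = n
n when false = 0

when-∧ : ∀ x p q → x when (p ∧ q) ≡ x when p when q
when-∧ x true  q     = refl
when-∧ x false true  = refl
when-∧ x false false = refl

when-comm : ∀ x p q → x when p when q ≡ x when q when p
when-comm x true  q     = refl
when-comm x false true  = refl
when-comm x false false = refl

when-+ : ∀ x y p → (x + y) when p ≡ x when p + y when p
when-+ x y true  = refl
when-+ x y false = refl

when-cong : ∀ {x y} p → (p ≡ true → x ≡ y) → x when p ≡ y when p
when-cong true  x≡y = x≡y refl
when-cong false x≡y = refl

*-one-when : ∀ x p → x * (1 when p) ≡ x when p
*-one-when x true  = *-identityʳ x
*-one-when x false = *-zeroʳ x

∸-suc : ∀ m n → m ∸ n ∸ 1 ≡ m ∸ suc n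
∸-suc m n = trans (∸-+-assoc m n 1) (cong (m ∸_) (+-comm n 1))

sum-map-+ : ∀ {A : Set} (f g : A → ℕ) xs →
  sum (map (λ x → f x + g x) xs) ≡ sum (map f xs) + sum (map g xs)
sum-map-+ f g []       = refl
sum-map-+ f g (x ∷ xs) = trans (cong (f x + g x +_) (sum-map-+ f g xs))
                               (interchange (f x) (g x) _ _)

sum-map-when : ∀ {A : Set} (f : A → ℕ) b xs →
  sum (map (λ x → f x when b) xs) ≡ sum (map f xs) when b
sum-map-when f true  xs       = refl
sum-map-when f false []       = refl
sum-map-when f false (x ∷ xs) = sum-map-when f false xs

sum-map-cong : ∀ {A : Set} {f g : A → ℕ} → (∀ x → f x ≡ g x) → ∀ xs → sum (map f xs) ≡ sum (map g xs)
sum-map-cong f≗g xs = cong sum (map-cong f≗g xs)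

sum-map-filter : ∀ {A : Set} (p : A → Bool) (f : A → ℕ) xs →
  sum (map f (filter (λ x → p x Data.Bool.≟ true) xs)) ≡ sum (map (λ x → f x when p x) xs)
sum-map-filter p f []       = refl
sum-map-filter p f (x ∷ xs) with p x
... | true  = cong (f x +_) (sum-map-filter p f xs)
... | false = sum-map-filter p f xs

length-filter-++ : ∀ {A : Set} {P : Pred A 0ℓ} (P? : Decidable P) xs ys →
  length (filter P? (xs ++ ys)) ≡ length (filter P? xs) + length (filter P? ys)
length-filter-++ P? xs ys = trans (cong length (filter-++ P? xs ys)) (length-++ (filter P? xs))

and-++ : ∀ xs ys → and (xs ++ ys) ≡ and xs ∧ and ys
and-++ []       ys = refl
and-++ (x ∷ xs) ys = trans (cong (x ∧_) (and-++ xs ys)) (sym (∧-assoc x (and xs) (and ys)))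

product-applyUpTo-suc : ∀ (f : ℕ → ℕ) n → product (applyUpTo f (suc n)) ≡ product (applyUpTo f n) * f n
product-applyUpTo-suc f n = begin
  product (applyUpTo f (suc n))        ≡⟨ cong product (sym (applyUpTo-∷ʳ f n)) ⟩
  product (applyUpTo f n ++ f n ∷ [])  ≡⟨ product-++ (applyUpTo f n) (f n ∷ []) ⟩
  product (applyUpTo f n) * (f n * 1)  ≡⟨ cong (product (applyUpTo f n) *_) (*-identityʳ (f n)) ⟩
  product (applyUpTo f n) * f n        ∎
  where open ≡-Reasoning

product-applyUpTo-cong : ∀ {f g : ℕ → ℕ} n → (∀ {m} → m < n → f m ≡ g m) →
  product (applyUpTo f n) ≡ product (applyUpTo g n)
product-applyUpTo-cong zero    f≗g = refl
product-applyUpTo-cong (suc n) f≗g = cong₂ _*_ (f≗g z<s) (product-applyUpTo-cong n (λ m<n → f≗g (s<s m<n)))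

⌊suc≟suc⌋ : ∀ m n → ⌊ suc m ≟ suc n ⌋ ≡ ⌊ m ≟ n ⌋
⌊suc≟suc⌋ m n = trans (isYes≗does (suc m ≟ suc n)) (sym (isYes≗does (m ≟ n)))

∧-extend : ∀ e s v {t t′} → (e ≡ true → s ≡ true → t ≡ t′) →
  e ∧ s ∧ (v ∧ t) ≡ (e ∧ s ∧ v) ∧ t′
∧-extend true  true  v t≡t′ = cong (v ∧_) (t≡t′ refl refl)
∧-extend true  false v t≡t′ = refl
∧-extend false s     v t≡t′ = refl

when-∧-cong : ∀ {x y} e {t t′} → (e ≡ true → x ≡ y) → t ≡ t′ → x when (e ∧ t) ≡ y when e when t′
when-∧-cong {x} e {t} x≡y t≡t′ = trans (when-∧ x e t) (cong₂ _when_ (when-cong e x≡y) t≡t′)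

raney : ℕ → ℕ → ℕ
raney zero    m       = 1
raney (suc j) zero    = 0
raney (suc j) (suc m) = raney (suc j) m + raney j (3 + m)

absorption : ∀ n k → suc k * (suc n C suc k) ≡ suc n * (n C k)
absorption zero    zero    = refl
absorption zero    (suc k) = *-zeroʳ (2 + k)
absorption (suc n) zero    = trans (*-identityˡ _) (trans (nC1≡n (2 + n)) (sym (*-identityʳ (2 + n))))
absorption (suc n) (suc k) = begin
  (2 + k) * ((2 + n) C (2 + k))
    ≡⟨ cong ((2 + k) *_) (sym (nCk+nC[k+1]≡[n+1]C[k+1] (suc n) (suc k))) ⟩
  (2 + k) * (x + y)
    ≡⟨ split k x y ⟩
  x + (suc k * x + (2 + k) * y)
    ≡⟨ cong₂ (λ u v → x + (u + v)) (absorption n k) (absorption n (suc k)) ⟩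
  x + (suc n * (n C k) + suc n * (n C suc k))
    ≡⟨ cong (x +_) (sym (*-distribˡ-+ (suc n) (n C k) (n C suc k))) ⟩
  x + suc n * (n C k + n C suc k)
    ≡⟨ cong (λ z → x + suc n * z) (nCk+nC[k+1]≡[n+1]C[k+1] n k) ⟩
  (2 + n) * x ∎
  where
  open ≡-Reasoning
  x = suc n C suc k
  y = suc n C (2 + k)
  split : ∀ k x y → (2 + k) * (x + y) ≡ x + (suc k * x + (2 + k) * y)
  split = solve-∀

raney-closed : ∀ j m → (j + j + suc m) * raney j (suc m) ≡ suc m * ((3 * j + m) C j)
raney-closed zero    m       = refl
raney-closed (suc j) zero    = begin
  (suc j + suc j + 1) * raney j 3   ≡⟨ cong (_* raney j 3) (regroup j) ⟩
  (j + j + 3) * raney j 3           ≡⟨ raney-closed j 2 ⟩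
  3 * c                             ≡⟨ sym tripled ⟩
  z                                 ≡⟨ sym (*-identityˡ z) ⟩
  1 * z                             ∎
  where
  open ≡-Reasoning
  c = (3 * j + 2) C j
  z = (3 * suc j + 0) C suc j
  regroup : ∀ j → suc j + suc j + 1 ≡ j + j + 3
  regroup = solve-∀
  index : ∀ j → suc (3 * j + 2) ≡ 3 * suc j + 0
  index = solve-∀
  scale : ∀ j c → suc (3 * j + 2) * c ≡ suc j * (3 * c)
  scale = solve-∀
  tripled : z ≡ 3 * c
  tripled = *-cancelˡ-≡ z (3 * c) (suc j) (begin
    suc j * z                        ≡⟨ cong (λ n → suc j * (n C suc j)) (sym (index j)) ⟩
    suc j * (suc (3 * j + 2) C suc j) ≡⟨ absorption (3 * j + 2) j ⟩
    suc (3 * j + 2) * c              ≡⟨ scale j c ⟩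
    suc j * (3 * c)                  ∎)
raney-closed (suc j) (suc m) = *-cancelˡ-≡ _ _ N (begin
  N * (N′ * (r₁ + r₂))                      ≡⟨ expand j m r₁ r₂ ⟩
  N′ * (N * r₁) + N * ((j + j + (4 + m)) * r₂)
    ≡⟨ cong₂ (λ u v → N′ * u + N * v) (raney-closed (suc j) m) ih₂ ⟩
  X                                         ≡⟨ +-cancelʳ-≡ _ X Y key ⟩
  Y                                         ≡⟨ cong (λ n → N * ((2 + m) * n)) pascal ⟩
  N * ((2 + m) * ((3 * suc j + suc m) C suc j)) ∎)
  where
  open ≡-Reasoning
  P  = 3 * suc j + m
  N  = suc j + suc j + suc m
  N′ = suc j + suc j + suc (suc m)
  r₁ = raney (suc j) (suc m)
  r₂ = raney j (4 + m)
  c  = P C j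
  c₁ = P C suc j
  X  = N′ * (suc m * c₁) + N * ((4 + m) * c)
  Y  = N * ((2 + m) * (c + c₁))
  expand : ∀ j m r₁ r₂ → (suc j + suc j + suc m) * ((suc j + suc j + suc (suc m)) * (r₁ + r₂))
    ≡ (suc j + suc j + suc (suc m)) * ((suc j + suc j + suc m) * r₁)
      + (suc j + suc j + suc m) * ((j + j + (4 + m)) * r₂)
  expand = solve-∀
  shift : ∀ j m → 3 * j + (3 + m) ≡ 3 * suc j + m
  shift = solve-∀
  ih₂ : (j + j + (4 + m)) * r₂ ≡ (4 + m) * c
  ih₂ = trans (raney-closed j (3 + m)) (cong (λ n → (4 + m) * (n C j)) (shift j m))
  pascal : c + c₁ ≡ (3 * suc j + suc m) C suc j
  pascal = trans (nCk+nC[k+1]≡[n+1]C[k+1] P j) (cong (_C suc j) (sym (+-suc (3 * suc j) m)))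
  -- The step is a polynomial identity only modulo (j + 1)·C(P + 1, j + 1) = (P + 1)·C(P, j),
  -- which is therefore added to both sides.
  balance : ∀ j m c c₁ →
    (suc j + suc j + suc (suc m)) * (suc m * c₁) + (suc j + suc j + suc m) * ((4 + m) * c)
      + 2 * (suc j * (c + c₁))
    ≡ (suc j + suc j + suc m) * ((2 + m) * (c + c₁)) + 2 * (suc (3 * suc j + m) * c)
  balance = solve-∀
  key : X + 2 * (suc P * c) ≡ Y + 2 * (suc P * c)
  key = begin
    X + 2 * (suc P * c)                  ≡⟨ cong (λ n → X + 2 * n) (sym (absorption P j)) ⟩
    X + 2 * (suc j * (suc P C suc j))    ≡⟨ cong (λ n → X + 2 * (suc j * n)) (sym (nCk+nC[k+1]≡[n+1]C[k+1] P j)) ⟩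
    X + 2 * (suc j * (c + c₁))           ≡⟨ balance j m c c₁ ⟩
    Y + 2 * (suc P * c)                  ∎

raney-two : ∀ j → raney j 2 ≡ ((3 * j + 1) C j) / suc j
raney-two j = sym (trans (cong (_/ suc j) ratio) (m*n/n≡m (raney j 2) (suc j)))
  where
  factor-two : ∀ j r → (j + j + 2) * r ≡ 2 * (suc j * r)
  factor-two = solve-∀
  ratio : (3 * j + 1) C j ≡ raney j 2 * suc j
  ratio = trans (sym (*-cancelˡ-≡ _ _ 2 (trans (sym (factor-two j (raney j 2))) (raney-closed j 1))))
                (*-comm (suc j) (raney j 2))

-- Unlike 2 * d, double (suc d) unfolds to suc (suc (double d)), so raney's recurrence computes.
double : ℕ → ℕ
double zero    = zero
double (suc n) = suc (suc (double n))

-- The weights W(a, b) and W⁻(a, b) of the path prefixes with a east and b south steps: the last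
-- step must land on or above the diagonal, and the vertex it adds counts in column a exactly
-- when it lies strictly above.
mutual
  prefixWeight⁻ prefixWeight : ℕ → ℕ → ℕ
  prefixWeight⁻ zero    zero    = 1
  prefixWeight⁻ (suc a) zero    = prefixWeight a zero
  prefixWeight⁻ zero    (suc b) = 0
  prefixWeight⁻ (suc a) (suc b) =
    (prefixWeight a (suc b) + prefixWeight⁻ (suc a) b) when does (suc b ≤? suc a)

  prefixWeight zero    zero    = 1
  prefixWeight (suc a) zero    = prefixWeight a zero
  prefixWeight zero    (suc b) = 0
  prefixWeight (suc a) (suc b) =
    (prefixWeight a (suc b) when does (suc b <? suc a)
      + (prefixWeight (suc a) b + prefixWeight⁻ (suc a) b when does (suc b <? suc a)))
    when does (suc b ≤? suc a)

prefixWeight-first-row : ∀ a → prefixWeight a zero ≡ 1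
prefixWeight-first-row zero    = refl
prefixWeight-first-row (suc a) = prefixWeight-first-row a

prefixWeight-below-diagonal : ∀ b → prefixWeight b (suc b) ≡ 0
prefixWeight-below-diagonal zero    = refl
prefixWeight-below-diagonal (suc b) rewrite dec-false (2 + b ≤? 1 + b) (n≮n (suc b)) = refl

prefixWeight-above-diagonal-step : ∀ b d →
  prefixWeight (d + suc b) (suc b) ≡ raney (suc b) (1 + double d) →
  prefixWeight⁻ (suc (suc d + b)) b ≡ raney b (4 + double d) ×
  prefixWeight  (suc (suc d + b)) b ≡ raney b (5 + double d) →
  prefixWeight⁻ (suc (d + suc b)) (suc b) ≡ raney (suc b) (2 + double d) ×
  prefixWeight  (suc (d + suc b)) (suc b) ≡ raney (suc b) (3 + double d)
prefixWeight-above-diagonal-step b d p (q⁻ , q)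
  rewrite dec-true (suc b ≤? suc (d + suc b)) (m≤n⇒m≤1+n (m≤n+m (suc b) d))
        | dec-true (suc b <? suc (d + suc b)) (s≤s (m≤n+m (suc b) d)) | p | +-suc d b | q⁻ | q
  = refl , comm-middle (raney (suc b) (1 + double d)) (raney b (5 + double d)) (raney b (4 + double d))
  where
  comm-middle : ∀ x y z → x + (y + z) ≡ x + z + y
  comm-middle = solve-∀

prefixWeight-diagonal-step : ∀ b →
  prefixWeight⁻ (suc b) b ≡ raney b 2 × prefixWeight (suc b) b ≡ raney b 3 →
  prefixWeight⁻ (suc b) (suc b) ≡ raney b 2 × prefixWeight (suc b) (suc b) ≡ raney b 3
prefixWeight-diagonal-step b (p⁻ , p)
  rewrite dec-true (suc b ≤? suc b) ≤-refl | dec-false (suc b <? suc b) (n≮n (suc b))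
        | prefixWeight-below-diagonal b | p⁻ | p
  = refl , +-identityʳ (raney b 3)

mutual
  prefixWeight-above-diagonal : ∀ b d →
    prefixWeight⁻ (suc (d + b)) b ≡ raney b (2 + double d) ×
    prefixWeight  (suc (d + b)) b ≡ raney b (3 + double d)
  prefixWeight-above-diagonal zero    d = prefixWeight-first-row (d + 0) , prefixWeight-first-row (d + 0)
  prefixWeight-above-diagonal (suc b) zero    = prefixWeight-above-diagonal-step b 0
    (proj₂ (prefixWeight-diagonal b)) (prefixWeight-above-diagonal b 1)
  prefixWeight-above-diagonal (suc b) (suc d) = prefixWeight-above-diagonal-step b (suc d)
    (proj₂ (prefixWeight-above-diagonal (suc b) d)) (prefixWeight-above-diagonal b (2 + d))

  prefixWeight-diagonal : ∀ b →
    prefixWeight⁻ (suc b) (suc b) ≡ raney b 2 × prefixWeight (suc b) (suc b) ≡ raney b 3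
  prefixWeight-diagonal b = prefixWeight-diagonal-step b (prefixWeight-above-diagonal b 0)

sum-map-words-suc : ∀ n (f : List Step → ℕ) → sum (map f (words (suc n)))
  ≡ sum (map (λ w → f (w ++ E ∷ []) + f (w ++ S ∷ [])) (words n))
sum-map-words-suc zero    f = sym (+-assoc (f (E ∷ [])) (f (S ∷ [])) 0)
sum-map-words-suc (suc n) f = begin
  sum (map f (words (2 + n)))
    ≡⟨ prepend f (words (suc n)) ⟩
  sum (map (λ v → f (E ∷ v) + f (S ∷ v)) (words (suc n)))
    ≡⟨ sum-map-words-suc n (λ v → f (E ∷ v) + f (S ∷ v)) ⟩
  sum (map (λ w → (f (E ∷ w ++ E ∷ []) + f (S ∷ w ++ E ∷ [])) + (f (E ∷ w ++ S ∷ []) + f (S ∷ w ++ S ∷ []))) (words n))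
    ≡⟨ sum-map-cong (λ w → interchange (f (E ∷ w ++ E ∷ [])) _ _ _) (words n) ⟩
  sum (map (λ w → (f (E ∷ w ++ E ∷ []) + f (E ∷ w ++ S ∷ [])) + (f (S ∷ w ++ E ∷ []) + f (S ∷ w ++ S ∷ []))) (words n))
    ≡⟨ prepend (λ u → f (u ++ E ∷ []) + f (u ++ S ∷ [])) (words n) ⟨
  sum (map (λ w → f (w ++ E ∷ []) + f (w ++ S ∷ [])) (words (suc n))) ∎
  where
  open ≡-Reasoning
  prepend : ∀ (f : List Step → ℕ) ws →
    sum (map f (concatMap (λ w → (E ∷ w) ∷ (S ∷ w) ∷ []) ws)) ≡ sum (map (λ w → f (E ∷ w) + f (S ∷ w)) ws)
  prepend f []       = refl
  prepend f (w ∷ ws) = trans (cong (λ n → f (E ∷ w) + (f (S ∷ w) + n)) (prepend f ws))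
                             (sym (+-assoc (f (E ∷ w)) (f (S ∷ w)) _))

sum-map-words-split : ∀ n (f : List Step → ℕ) → sum (map f (words (suc n)))
  ≡ sum (map (λ w → f (w ++ E ∷ [])) (words n)) + sum (map (λ w → f (w ++ S ∷ [])) (words n))
sum-map-words-split n f = trans (sum-map-words-suc n f) (sum-map-+ _ _ (words n))

endpoint : Point → List Step → Point
endpoint p []      = p
endpoint p (s ∷ w) = endpoint (step s p) w

endpoint-≡ : ∀ x y w → endpoint (x , y) w ≡ (x + countE w , y ∸ countS w)
endpoint-≡ x y []      = cong (_, y) (sym (+-identityʳ x))
endpoint-≡ x y (E ∷ w) = trans (endpoint-≡ (suc x) y w) (cong (_, y ∸ countS w) (sym (+-suc x (countE w))))
endpoint-≡ x y (S ∷ w) = trans (endpoint-≡ x (y ∸ 1) w) (cong (x + countE w ,_) (∸-+-assoc y 1 (countS w)))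

verticesFrom-∷ʳ : ∀ p w s → verticesFrom p (w ++ s ∷ []) ≡ verticesFrom p w ++ step s (endpoint p w) ∷ []
verticesFrom-∷ʳ p []      s = refl
verticesFrom-∷ʳ p (t ∷ w) s = cong (p ∷_) (verticesFrom-∷ʳ (step t p) w s)

verticesFrom-left : ∀ x y w → All (λ q → proj₁ q ≤ x + countE w) (verticesFrom (x , y) w)
verticesFrom-left x y []      = m≤m+n x 0 ∷ []
verticesFrom-left x y (E ∷ w) = m≤m+n x _ ∷
  subst (λ n → All (λ q → proj₁ q ≤ n) (verticesFrom (suc x , y) w)) (sym (+-suc x (countE w)))
        (verticesFrom-left (suc x) y w)
verticesFrom-left x y (S ∷ w) = m≤m+n x _ ∷ verticesFrom-left x (y ∸ 1) w

countE-∷ʳ : ∀ w s → countE (w ++ s ∷ []) ≡ countE (s ∷ []) + countE w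
countE-∷ʳ w s = trans (length-filter-++ _ w (s ∷ [])) (+-comm (countE w) _)

countS-∷ʳ : ∀ w s → countS (w ++ s ∷ []) ≡ countS (s ∷ []) + countS w
countS-∷ʳ w s = trans (length-filter-++ _ w (s ∷ [])) (+-comm (countS w) _)

module _ (k : ℕ) where

  above : Point → Bool
  above p = ⌊ k ≤? proj₁ p + proj₂ p ⌋

  valid : List Step → Bool
  valid w = and (map above (vertices k w))

  endsAt : ℕ → ℕ → List Step → Bool
  endsAt a b w = ⌊ countE w ≟ a ⌋ ∧ ⌊ countS w ≟ b ⌋ ∧ valid w

  inColumn : (i : ℕ) (p : Point) → Dec ((proj₁ p ≡ i) × (k < i + proj₂ p))
  inColumn i p = (proj₁ p ≟ i) ×-dec (k <? i + proj₂ p)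

  columnProduct : ℕ → List Step → ℕ
  columnProduct n w = product (applyUpTo (λ m → column k w (suc m)) n)

  weightSum⁻ weightSum : ℕ → ℕ → ℕ → ℕ
  weightSum⁻ n a b = sum (map (λ w → columnProduct (pred a) w when endsAt a b w) (words n))
  weightSum  n a b = sum (map (λ w → columnProduct a w when endsAt a b w) (words n))

  depth-⇔ : ∀ {c} m x → c ≤ k → (m + k ≤ x + (k ∸ c)) ⇔ (m + c ≤ x)
  depth-⇔ {c} m x c≤k = subst (λ n → n ≤ x + (k ∸ c) ⇔ m + c ≤ x) m+c+[k∸c]≡m+k
    (mk⇔ (+-cancelʳ-≤ (k ∸ c) (m + c) x) (+-monoˡ-≤ (k ∸ c)))
    where
    m+c+[k∸c]≡m+k : m + c + (k ∸ c) ≡ m + k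
    m+c+[k∸c]≡m+k = trans (+-assoc m c (k ∸ c)) (cong (m +_) (m+[n∸m]≡n c≤k))

  above-≡ : ∀ {c} x → c ≤ k → above (x , k ∸ c) ≡ does (c ≤? x)
  above-≡ x c≤k = trans (isYes≗does (k ≤? x + _)) (does-⇔ (depth-⇔ 0 x c≤k) (k ≤? x + _) (_ ≤? x))

  strictly-above-≡ : ∀ {c} x → c ≤ k → does (k <? x + (k ∸ c)) ≡ does (c <? x)
  strictly-above-≡ x c≤k = does-⇔ (depth-⇔ 1 x c≤k) (k <? x + _) (_ <? x)

  counts-endpoint : ∀ {a b} w → ⌊ countE w ≟ a ⌋ ≡ true → ⌊ countS w ≟ b ⌋ ≡ true →
    endpoint (0 , k) w ≡ (a , k ∸ b)
  counts-endpoint {a} {b} w with countE w ≟ a | countS w ≟ b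
  ... | yes refl | yes refl = λ _ _ → endpoint-≡ 0 k w
  ... | yes _    | no _     = λ _ ()
  ... | no _     | _        = λ ()

  valid-∷ʳ : ∀ w s → valid (w ++ s ∷ []) ≡ valid w ∧ above (step s (endpoint (0 , k) w))
  valid-∷ʳ w s rewrite verticesFrom-∷ʳ (0 , k) w s | map-++ above (vertices k w) (step s (endpoint (0 , k) w) ∷ []) =
    trans (and-++ (map above (vertices k w)) _) (cong (valid w ∧_) (∧-identityʳ _))

  endsAt-∷ʳE : ∀ a b w → endsAt (suc a) b (w ++ E ∷ []) ≡ endsAt a b w ∧ above (suc a , k ∸ b)
  endsAt-∷ʳE a b w rewrite countE-∷ʳ w E | countS-∷ʳ w E | valid-∷ʳ w E | ⌊suc≟suc⌋ (countE w) a =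
    ∧-extend ⌊ countE w ≟ a ⌋ ⌊ countS w ≟ b ⌋ (valid w)
      (λ e s → cong (λ p → above (step E p)) (counts-endpoint w e s))

  endsAt-∷ʳS : ∀ a b w → endsAt a (suc b) (w ++ S ∷ []) ≡ endsAt a b w ∧ above (a , k ∸ suc b)
  endsAt-∷ʳS a b w rewrite countE-∷ʳ w S | countS-∷ʳ w S | valid-∷ʳ w S | ⌊suc≟suc⌋ (countS w) b =
    ∧-extend ⌊ countE w ≟ a ⌋ ⌊ countS w ≟ b ⌋ (valid w)
      (λ e s → trans (cong (λ p → above (step S p)) (counts-endpoint w e s))
                     (cong (λ y → above (a , y)) (∸-suc k b)))

  endsAt-∷ʳE-first-column : ∀ b w → endsAt 0 b (w ++ E ∷ []) ≡ false
  endsAt-∷ʳE-first-column b w rewrite countE-∷ʳ w E = refl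

  endsAt-∷ʳS-first-row : ∀ a w → endsAt a 0 (w ++ S ∷ []) ≡ false
  endsAt-∷ʳS-first-row a w rewrite countS-∷ʳ w S = ∧-zeroʳ _

  endsAt-endpoint : ∀ a b w → endsAt a b w ≡ true → endpoint (0 , k) w ≡ (a , k ∸ b)
  endsAt-endpoint a b w with ⌊ countE w ≟ a ⌋ in e | ⌊ countS w ≟ b ⌋ in s
  ... | true  | true  = λ _ → counts-endpoint w e s
  ... | true  | false = λ ()
  ... | false | _     = λ ()

  endsAt-origin : endsAt 0 0 [] ≡ true
  endsAt-origin = cong (_∧ true) (above-≡ 0 z≤n)

  column-∷ʳ : ∀ w s i → column k (w ++ s ∷ []) i
    ≡ column k w i + length (filter (inColumn i) (step s (endpoint (0 , k) w) ∷ []))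
  column-∷ʳ w s i rewrite verticesFrom-∷ʳ (0 , k) w s = length-filter-++ (inColumn i) (vertices k w) _

  column-beyond : ∀ w i → proj₁ (endpoint (0 , k) w) < i → column k w i ≡ 0
  column-beyond w i x<i rewrite endpoint-≡ 0 k w =
    cong length (filter-none (inColumn i)
      (All.map (λ q≤x (q≡i , _) → <⇒≱ x<i (subst (_≤ countE w) q≡i q≤x)) (verticesFrom-left 0 k w)))

  inColumn-here : ∀ i y → length (filter (inColumn i) ((i , y) ∷ [])) ≡ 1 when does (k <? i + y)
  inColumn-here i y rewrite dec-true (i ≟ i) refl with does (k <? i + y)
  ... | true  = refl
  ... | false = refl

  inColumn-elsewhere : ∀ {i} p → proj₁ p ≢ i → length (filter (inColumn i) (p ∷ [])) ≡ 0
  inColumn-elsewhere {i} p p≢i = cong length (filter-reject (inColumn i) (λ (p≡i , _) → p≢i p≡i))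

  columnProduct-∷ʳ-left : ∀ n w s → n ≤ pred (proj₁ (step s (endpoint (0 , k) w))) →
    columnProduct n (w ++ s ∷ []) ≡ columnProduct n w
  columnProduct-∷ʳ-left n w s n≤x = product-applyUpTo-cong n (λ {m} m<n → begin
    column k (w ++ s ∷ []) (suc m)
      ≡⟨ column-∷ʳ w s (suc m) ⟩
    column k w (suc m) + length (filter (inColumn (suc m)) (step s (endpoint (0 , k) w) ∷ []))
      ≡⟨ cong (column k w (suc m) +_) (inColumn-elsewhere (step s (endpoint (0 , k) w)) (new≢ m<n)) ⟩
    column k w (suc m) + 0
      ≡⟨ +-identityʳ _ ⟩
    column k w (suc m) ∎)
    where
    open ≡-Reasoning
    new≢ : ∀ {m} → m < n → proj₁ (step s (endpoint (0 , k) w)) ≢ suc m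
    new≢ m<n x≡1+m = <-irrefl refl (≤-trans m<n (subst (λ x → n ≤ pred x) x≡1+m n≤x))

  columnProduct-∷ʳE-left : ∀ a b w → endsAt a b w ≡ true → columnProduct a (w ++ E ∷ []) ≡ columnProduct a w
  columnProduct-∷ʳE-left a b w at =
    columnProduct-∷ʳ-left a w E (≤-reflexive (sym (cong proj₁ (endsAt-endpoint a b w at))))

  columnProduct-∷ʳS-left : ∀ a b w → endsAt a b w ≡ true →
    columnProduct (pred a) (w ++ S ∷ []) ≡ columnProduct (pred a) w
  columnProduct-∷ʳS-left a b w at =
    columnProduct-∷ʳ-left (pred a) w S (≤-reflexive (sym (cong (pred ∘ proj₁) (endsAt-endpoint a b w at))))

  columnProduct-∷ʳE : ∀ a b w → b ≤ k → endsAt a b w ≡ true →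
    columnProduct (suc a) (w ++ E ∷ []) ≡ columnProduct a w when does (b <? suc a)
  columnProduct-∷ʳE a b w b≤k at = begin
    columnProduct (suc a) (w ++ E ∷ [])
      ≡⟨ product-applyUpTo-suc _ a ⟩
    columnProduct a (w ++ E ∷ []) * column k (w ++ E ∷ []) (suc a)
      ≡⟨ cong₂ _*_ (columnProduct-∷ʳE-left a b w at) (column-∷ʳ w E (suc a)) ⟩
    columnProduct a w * (column k w (suc a) + new (endpoint (0 , k) w))
      ≡⟨ cong₂ (λ c p → columnProduct a w * (c + new p))
               (column-beyond w (suc a) (≤-reflexive (cong (suc ∘ proj₁) end≡))) end≡ ⟩
    columnProduct a w * new (a , k ∸ b)
      ≡⟨ cong (columnProduct a w *_) (inColumn-here (suc a) (k ∸ b)) ⟩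
    columnProduct a w * (1 when does (k <? suc a + (k ∸ b)))
      ≡⟨ *-one-when (columnProduct a w) _ ⟩
    columnProduct a w when does (k <? suc a + (k ∸ b))
      ≡⟨ cong (columnProduct a w when_) (strictly-above-≡ (suc a) b≤k) ⟩
    columnProduct a w when does (b <? suc a) ∎
    where
    open ≡-Reasoning
    end≡ = endsAt-endpoint a b w at
    new : Point → ℕ
    new p = length (filter (inColumn (suc a)) (step E p ∷ []))

  columnProduct-∷ʳS : ∀ a b w → suc b ≤ k → endsAt a b w ≡ true →
    columnProduct a (w ++ S ∷ []) ≡ columnProduct a w + columnProduct (pred a) w when does (suc b <? a)
  columnProduct-∷ʳS zero    b w b<k at = refl
  columnProduct-∷ʳS (suc a) b w b<k at = begin
    columnProduct (suc a) (w ++ S ∷ [])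
      ≡⟨ product-applyUpTo-suc _ a ⟩
    columnProduct a (w ++ S ∷ []) * column k (w ++ S ∷ []) (suc a)
      ≡⟨ cong₂ _*_ (columnProduct-∷ʳS-left (suc a) b w at) (column-∷ʳ w S (suc a)) ⟩
    columnProduct a w * (column k w (suc a) + new (endpoint (0 , k) w))
      ≡⟨ cong (λ p → columnProduct a w * (column k w (suc a) + new p)) (endsAt-endpoint (suc a) b w at) ⟩
    columnProduct a w * (column k w (suc a) + new (suc a , k ∸ b))
      ≡⟨ cong (λ n → columnProduct a w * (column k w (suc a) + n))
              (trans (inColumn-here (suc a) (k ∸ b ∸ 1))
                     (cong (λ y → 1 when does (k <? suc a + y)) (∸-suc k b))) ⟩
    columnProduct a w * (column k w (suc a) + 1 when does (k <? suc a + (k ∸ suc b)))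
      ≡⟨ *-distribˡ-+ (columnProduct a w) _ _ ⟩
    columnProduct a w * column k w (suc a) + columnProduct a w * (1 when does (k <? suc a + (k ∸ suc b)))
      ≡⟨ cong₂ _+_ (sym (product-applyUpTo-suc _ a)) (*-one-when (columnProduct a w) _) ⟩
    columnProduct (suc a) w + columnProduct a w when does (k <? suc a + (k ∸ suc b))
      ≡⟨ cong (λ t → columnProduct (suc a) w + columnProduct a w when t) (strictly-above-≡ (suc a) b<k) ⟩
    columnProduct (suc a) w + columnProduct a w when does (suc b <? suc a) ∎
    where
    open ≡-Reasoning
    new : Point → ℕ
    new p = length (filter (inColumn (suc a)) (step S p ∷ []))

  weightSum⁻-∷ʳE : ∀ n a b → b ≤ k →
    sum (map (λ w → columnProduct a (w ++ E ∷ []) when endsAt (suc a) b (w ++ E ∷ [])) (words n))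
      ≡ weightSum n a b when does (b ≤? suc a)
  weightSum⁻-∷ʳE n a b b≤k = trans (sum-map-cong extend (words n)) (sum-map-when _ _ (words n))
    where
    extend : ∀ w → columnProduct a (w ++ E ∷ []) when endsAt (suc a) b (w ++ E ∷ [])
                   ≡ columnProduct a w when endsAt a b w when does (b ≤? suc a)
    extend w = trans (cong (_ when_) (endsAt-∷ʳE a b w))
                     (when-∧-cong (endsAt a b w) (columnProduct-∷ʳE-left a b w) (above-≡ (suc a) b≤k))

  weightSum-∷ʳE : ∀ n a b → b ≤ k →
    sum (map (λ w → columnProduct (suc a) (w ++ E ∷ []) when endsAt (suc a) b (w ++ E ∷ [])) (words n))
      ≡ weightSum n a b when does (b <? suc a) when does (b ≤? suc a)
  weightSum-∷ʳE n a b b≤k =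
    trans (sum-map-cong extend (words n))
          (trans (sum-map-when _ _ (words n)) (cong (_when does (b ≤? suc a)) (sum-map-when _ _ (words n))))
    where
    extend : ∀ w → columnProduct (suc a) (w ++ E ∷ []) when endsAt (suc a) b (w ++ E ∷ [])
                   ≡ columnProduct a w when endsAt a b w when does (b <? suc a) when does (b ≤? suc a)
    extend w = trans (cong (_ when_) (endsAt-∷ʳE a b w))
                     (trans (when-∧-cong (endsAt a b w) (columnProduct-∷ʳE a b w b≤k) (above-≡ (suc a) b≤k))
                            (cong (_when does (b ≤? suc a)) (when-comm (columnProduct a w) _ (endsAt a b w))))

  weightSum⁻-∷ʳS : ∀ n a b → suc b ≤ k →
    sum (map (λ w → columnProduct (pred a) (w ++ S ∷ []) when endsAt a (suc b) (w ++ S ∷ [])) (words n))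
      ≡ weightSum⁻ n a b when does (suc b ≤? a)
  weightSum⁻-∷ʳS n a b b<k = trans (sum-map-cong extend (words n)) (sum-map-when _ _ (words n))
    where
    extend : ∀ w → columnProduct (pred a) (w ++ S ∷ []) when endsAt a (suc b) (w ++ S ∷ [])
                   ≡ columnProduct (pred a) w when endsAt a b w when does (suc b ≤? a)
    extend w = trans (cong (_ when_) (endsAt-∷ʳS a b w))
                     (when-∧-cong (endsAt a b w) (columnProduct-∷ʳS-left a b w) (above-≡ a b<k))

  weightSum-∷ʳS : ∀ n a b → suc b ≤ k →
    sum (map (λ w → columnProduct a (w ++ S ∷ []) when endsAt a (suc b) (w ++ S ∷ [])) (words n))
      ≡ (weightSum n a b + weightSum⁻ n a b when does (suc b <? a)) when does (suc b ≤? a)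
  weightSum-∷ʳS n a b b<k =
    trans (sum-map-cong extend (words n))
          (trans (sum-map-when _ _ (words n))
                 (cong (_when does (suc b ≤? a))
                       (trans (sum-map-+ _ _ (words n)) (cong (weightSum n a b +_) (sum-map-when _ _ (words n))))))
    where
    extend : ∀ w → columnProduct a (w ++ S ∷ []) when endsAt a (suc b) (w ++ S ∷ [])
                   ≡ (columnProduct a w when endsAt a b w
                      + columnProduct (pred a) w when endsAt a b w when does (suc b <? a)) when does (suc b ≤? a)
    extend w = trans (cong (_ when_) (endsAt-∷ʳS a b w))
      (trans (when-∧-cong (endsAt a b w) (columnProduct-∷ʳS a b w b<k) (above-≡ a b<k))
             (cong (_when does (suc b ≤? a)) (trans (when-+ (columnProduct a w) _ (endsAt a b w))
                                    (cong (columnProduct a w when endsAt a b w +_)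
                                          (when-comm (columnProduct (pred a) w) _ (endsAt a b w))))))

  sum-∷ʳE-first-column : ∀ n b (f : List Step → ℕ) →
    sum (map (λ w → f (w ++ E ∷ []) when endsAt 0 b (w ++ E ∷ [])) (words n)) ≡ 0
  sum-∷ʳE-first-column n b f =
    trans (sum-map-cong (λ w → cong (f (w ++ E ∷ []) when_) (endsAt-∷ʳE-first-column b w)) (words n))
          (sum-map-when (λ w → f (w ++ E ∷ [])) false (words n))

  sum-∷ʳS-first-row : ∀ n a (f : List Step → ℕ) →
    sum (map (λ w → f (w ++ S ∷ []) when endsAt a 0 (w ++ S ∷ [])) (words n)) ≡ 0
  sum-∷ʳS-first-row n a f =
    trans (sum-map-cong (λ w → cong (f (w ++ S ∷ []) when_) (endsAt-∷ʳS-first-row a w)) (words n))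
          (sum-map-when (λ w → f (w ++ S ∷ [])) false (words n))

  weightSum⁻-suc : ∀ n a b → suc b ≤ k → weightSum⁻ (suc n) (suc a) (suc b)
    ≡ (weightSum n a (suc b) + weightSum⁻ n (suc a) b) when does (suc b ≤? suc a)
  weightSum⁻-suc n a b b<k =
    trans (sum-map-words-split n _)
      (trans (cong₂ _+_ (weightSum⁻-∷ʳE n a (suc b) b<k) (weightSum⁻-∷ʳS n (suc a) b b<k))
             (sym (when-+ _ _ (does (suc b ≤? suc a)))))

  weightSum-suc : ∀ n a b → suc b ≤ k → weightSum (suc n) (suc a) (suc b)
    ≡ (weightSum n a (suc b) when does (suc b <? suc a)
        + (weightSum n (suc a) b + weightSum⁻ n (suc a) b when does (suc b <? suc a)))
      when does (suc b ≤? suc a)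
  weightSum-suc n a b b<k =
    trans (sum-map-words-split n _)
      (trans (cong₂ _+_ (weightSum-∷ʳE n a (suc b) b<k) (weightSum-∷ʳS n (suc a) b b<k))
             (sym (when-+ _ _ (does (suc b ≤? suc a)))))

  weightSum≡prefixWeight : ∀ n a b → a + b ≡ n → b ≤ k →
    weightSum⁻ n a b ≡ prefixWeight⁻ a b × weightSum n a b ≡ prefixWeight a b
  weightSum≡prefixWeight zero zero    zero    refl b≤k rewrite endsAt-origin = refl , refl
  weightSum≡prefixWeight (suc n) (suc a) zero e b≤k =
    trans (sum-map-words-split n _)
      (trans (cong₂ _+_ (weightSum⁻-∷ʳE n a 0 z≤n) (sum-∷ʳS-first-row n (suc a) (columnProduct a)))
             (trans (+-identityʳ _) (proj₂ west))) ,
    trans (sum-map-words-split n _)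
      (trans (cong₂ _+_ (weightSum-∷ʳE n a 0 z≤n) (sum-∷ʳS-first-row n (suc a) (columnProduct (suc a))))
             (trans (+-identityʳ _) (proj₂ west)))
    where
    west = weightSum≡prefixWeight n a 0 (suc-injective e) z≤n
  weightSum≡prefixWeight (suc n) zero (suc b) e b≤k =
    trans (sum-map-words-split n _)
      (cong₂ _+_ (sum-∷ʳE-first-column n (suc b) (columnProduct 0)) (weightSum⁻-∷ʳS n 0 b b≤k)) ,
    trans (sum-map-words-split n _)
      (cong₂ _+_ (sum-∷ʳE-first-column n (suc b) (columnProduct 0)) (weightSum-∷ʳS n 0 b b≤k))
  weightSum≡prefixWeight (suc n) (suc a) (suc b) e b≤k =
    trans (weightSum⁻-suc n a b b≤k)
      (cong (_when does (suc b ≤? suc a)) (cong₂ _+_ (proj₂ west) (proj₁ north))) ,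
    trans (weightSum-suc n a b b≤k) (cong (_when does (suc b ≤? suc a))
      (cong₂ (λ x y → x when does (suc b <? suc a) + y) (proj₂ west)
             (cong₂ (λ x y → x + y when does (suc b <? suc a)) (proj₂ north) (proj₁ north))))
    where
    west  = weightSum≡prefixWeight n a (suc b) (suc-injective e) b≤k
    north = weightSum≡prefixWeight n (suc a) b (trans (sym (+-suc a b)) (suc-injective e)) (<⇒≤ b≤k)

proposition4p9 : (k : ℕ) → .{{_ : NonZero k}} →
    sum (map (wt k) (Dyck k)) ≡ ((3 * k ∸ 2) C (k ∸ 1)) / k
proposition4p9 k@(suc j) = begin
  sum (map (wt k) (Dyck k))    ≡⟨ sum-map-filter (isDyck? k) (wt k) (words (k + k)) ⟩
  weightSum⁻ k (k + k) k k     ≡⟨ proj₁ (weightSum≡prefixWeight k (k + k) k k refl ≤-refl) ⟩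
  prefixWeight⁻ k k            ≡⟨ proj₁ (prefixWeight-diagonal j) ⟩
  raney j 2                    ≡⟨ raney-two j ⟩
  ((3 * j + 1) C j) / k        ≡⟨ cong (λ n → (n C j) / k) index ⟩
  ((3 * k ∸ 2) C (k ∸ 1)) / k  ∎
  where
  open ≡-Reasoning
  3[1+j]≡2+[3j+1] : ∀ j → 3 * suc j ≡ 2 + (3 * j + 1)
  3[1+j]≡2+[3j+1] = solve-∀
  index : 3 * j + 1 ≡ 3 * k ∸ 2
  index = trans (sym (m+n∸m≡n 2 (3 * j + 1))) (cong (_∸ 2) (sym (3[1+j]≡2+[3j+1] j)))
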